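{- Let $\Delta'$ be a simplicial complex, $\ell$ a locally acyclic orientation of $\Delta'$, and $\Delta=(\Delta'\times[-1,1])^{\ell}$ the simplicial refinement of $\Delta'\times[-1,1]$ induced by $\ell$. Then for every vertex $u$ of $\Delta'$, $$\mathrm{lk}_{\Delta}((u,1))\cap\mathrm{lk}_{\Delta}((u,-1))=\mathrm{lk}_{\Delta}(\{(u,1),(u,-1)\}).$$
   Context: $\mathrm{lk}_\Delta(F)=\{G\in\Delta: G\cup F\in\Delta,\ G\cap F=\emptyset\}$. A locally acyclic orientation of $\Delta'$ is an orientation of the edges of its graph such that no $2$-simplex contains an oriented cycle. $(\Delta'\times[-1,1])^{\ell}$ is the simplicial complex on vertex set $V(\Delta')\times\{ -1,1\}$ whose edges are $\{(u,1),(u,-1)\}$, $\{(u,t),(w,t)\}$ for $t=\pm1$ and $\{u,w\}\in\Delta'$, and $\{(u,1),(w,-1)\}$ for each edge oriented $u\to w$; its faces are the vertex sets whose projection to $V(\Delta')$ is a face of $\Delta'$ and any two of whose elements form an edge. -}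

module Defs where

open import Level using (0ℓ)
open import Data.Nat using (ℕ)
open import Data.Fin using (Fin)
import Data.Fin.Properties as FinP
open import Data.Bool using (Bool; true; false; _∨_; _∧_; not)
import Data.Bool.Properties as BoolP
open import Data.Product using (Σ; _×_; _,_)
open import Data.Product.Properties using (≡-dec)
open import Data.Sum using (_⊎_)
open import Relation.Nullary using (¬_; does)
open import Relation.Binary.PropositionalEquality using (_≡_; _≢_)
open import Relation.Binary.Definitions using (DecidableEquality)

SubsetOf : Set → Set
SubsetOf V = V → Bool

_∈ˢ_ : {V : Set} → V → SubsetOf V → Set
v ∈ˢ A = A v ≡ true

_⊆ˢ_ : {V : Set} → SubsetOf V → SubsetOf V → Set
A ⊆ˢ B = ∀ v → v ∈ˢ A → v ∈ˢ B

_∪ˢ_ : {V : Set} → SubsetOf V → SubsetOf V → SubsetOf V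
(A ∪ˢ B) v = A v ∨ B v

Disjoint : {V : Set} → SubsetOf V → SubsetOf V → Set
Disjoint A B = ∀ v → v ∈ˢ A → v ∈ˢ B → Data.Empty.⊥
  where import Data.Empty

singleton : {V : Set} → DecidableEquality V → V → SubsetOf V
singleton dec v w = does (dec v w)

pair : {V : Set} → DecidableEquality V → V → V → SubsetOf V
pair dec v w = singleton dec v ∪ˢ singleton dec w

record SimplicialComplex (n : ℕ) : Set₁ where
  field
    IsFace      : SubsetOf (Fin n) → Set
    empty-face  : IsFace (λ _ → false)
    down-closed : ∀ A B → A ⊆ˢ B → IsFace B → IsFace A

module _ {n : ℕ} (K : SimplicialComplex n) where
  open SimplicialComplex K

  IsVertex : Fin n → Set
  IsVertex u = IsFace (singleton FinP._≟_ u)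

  IsEdge : Fin n → Fin n → Set
  IsEdge u w = u ≢ w × IsFace (pair FinP._≟_ u w)

  record Orientation : Set₁ where
    field
      _⟶_        : Fin n → Fin n → Set
      on-edges   : ∀ u w → u ⟶ w → IsEdge u w
      some-dir   : ∀ u w → IsEdge u w → (u ⟶ w) ⊎ (w ⟶ u)
      antisym    : ∀ u w → u ⟶ w → ¬ (w ⟶ u)

  LocallyAcyclic : Orientation → Set
  LocallyAcyclic o = ∀ a b c →
      IsFace (pair FinP._≟_ a b ∪ˢ singleton FinP._≟_ c) →
      ¬ ((a ⟶ b) × (b ⟶ c) × (c ⟶ a))
    where open Orientation o

-- Vertex set of the refinement: V(Δ') × {-1,1}, with true = 1, false = -1.
PVert : ℕ → Set
PVert n = Fin n × Bool

_≟ᴾ_ : {n : ℕ} → DecidableEquality (PVert n)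
_≟ᴾ_ = ≡-dec FinP._≟_ BoolP._≟_

module _ {n : ℕ} (K : SimplicialComplex n) (o : Orientation K) where
  open SimplicialComplex K
  open Orientation o

  proj : SubsetOf (PVert n) → SubsetOf (Fin n)
  proj G u = G (u , true) ∨ G (u , false)

  RefEdge : PVert n → PVert n → Set
  RefEdge (u , s) (w , t) =
      (u ≡ w × s ≢ t × IsVertex K u)
    ⊎ (s ≡ t × IsEdge K u w)
    ⊎ (s ≡ true × t ≡ false × u ⟶ w)
    ⊎ (s ≡ false × t ≡ true × w ⟶ u)

  RefFace : SubsetOf (PVert n) → Set
  RefFace G = IsFace (proj G) ×
    (∀ x y → x ∈ˢ G → y ∈ˢ G → x ≢ y → RefEdge x y)

lk : {V : Set} → (SubsetOf V → Set) → SubsetOf V → SubsetOf V → Set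
lk Face F G = Face G × Face (G ∪ˢ F) × Disjoint G F

module Submission where

-- G lies in the links of (u,1) and (u,-1) iff G ∪ {(u,1)} and G ∪ {(u,-1)}
-- are faces.  Their union has the same projection to Δ' as G ∪ {(u,1)}, and
-- every pair in it lies in one of the two faces except {(u,1),(u,-1)}, a
-- vertical edge because u is a vertex; as faces are exactly the cliques of
-- edges over faces of Δ', the union is a face.

open import Defs
open import Data.Nat using (ℕ)
open import Data.Fin using (Fin)
import Data.Fin.Properties as FinP
open import Data.Bool using (true; false)
open import Data.Product using (_×_; _,_; ∃)
open import Data.Empty using (⊥-elim)
open import Data.Sum using (_⊎_; inj₁; inj₂)
open import Function.Bundles using (_⇔_; mk⇔)
open import Relation.Nullary using (yes; no)
open import Relation.Binary.Definitions using (DecidableEquality)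
open import Relation.Binary.PropositionalEquality using (_≡_; _≢_; refl; sym)

module _ {V : Set} where

  ∪ˢ-introˡ : ∀ (A B : SubsetOf V) {v} → v ∈ˢ A → v ∈ˢ (A ∪ˢ B)
  ∪ˢ-introˡ A B {v} v∈A rewrite v∈A = refl

  ∪ˢ-introʳ : ∀ (A B : SubsetOf V) {v} → v ∈ˢ B → v ∈ˢ (A ∪ˢ B)
  ∪ˢ-introʳ A B {v} v∈B with A v
  ... | true  = refl
  ... | false = v∈B

  ∪ˢ-elim : ∀ (A B : SubsetOf V) {v} → v ∈ˢ (A ∪ˢ B) → v ∈ˢ A ⊎ v ∈ˢ B
  ∪ˢ-elim A B {v} v∈A∪B with A v
  ... | true  = inj₁ refl
  ... | false = inj₂ v∈A∪B

  ⊆-∪ˢˡ : ∀ (A B : SubsetOf V) → A ⊆ˢ (A ∪ˢ B)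
  ⊆-∪ˢˡ A B _ = ∪ˢ-introˡ A B

  ⊆-∪ˢʳ : ∀ (A B : SubsetOf V) → B ⊆ˢ (A ∪ˢ B)
  ⊆-∪ˢʳ A B _ = ∪ˢ-introʳ A B

  ∪ˢ-comm-⊆ : ∀ (A B : SubsetOf V) → (A ∪ˢ B) ⊆ˢ (B ∪ˢ A)
  ∪ˢ-comm-⊆ A B v v∈ with ∪ˢ-elim A B v∈
  ... | inj₁ v∈A = ∪ˢ-introʳ B A v∈A
  ... | inj₂ v∈B = ∪ˢ-introˡ B A v∈B

  ∪ˢ-monoʳ : ∀ {A B C : SubsetOf V} → B ⊆ˢ C → (A ∪ˢ B) ⊆ˢ (A ∪ˢ C)
  ∪ˢ-monoʳ {A} {B} {C} B⊆C v v∈A∪B with ∪ˢ-elim A B v∈A∪B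
  ... | inj₁ v∈A = ∪ˢ-introˡ A C v∈A
  ... | inj₂ v∈B = ∪ˢ-introʳ A C (B⊆C v v∈B)

  ∪ˢ-distribˡ-⊆ : ∀ {A B C : SubsetOf V} → (A ∪ˢ (B ∪ˢ C)) ⊆ˢ ((A ∪ˢ B) ∪ˢ (A ∪ˢ C))
  ∪ˢ-distribˡ-⊆ {A} {B} {C} v v∈ with ∪ˢ-elim A (B ∪ˢ C) v∈
  ... | inj₁ v∈A = ∪ˢ-introˡ (A ∪ˢ B) (A ∪ˢ C) (∪ˢ-introˡ A B v∈A)
  ... | inj₂ v∈B∪C with ∪ˢ-elim B C v∈B∪C
  ...   | inj₁ v∈B = ∪ˢ-introˡ (A ∪ˢ B) (A ∪ˢ C) (∪ˢ-introʳ A B v∈B)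
  ...   | inj₂ v∈C = ∪ˢ-introʳ (A ∪ˢ B) (A ∪ˢ C) (∪ˢ-introʳ A C v∈C)

  Disjoint-⊆ʳ : ∀ {G A B : SubsetOf V} → A ⊆ˢ B → Disjoint G B → Disjoint G A
  Disjoint-⊆ʳ A⊆B disj v v∈G v∈A = disj v v∈G (A⊆B v v∈A)

  Disjoint-∪ˢ : ∀ {G A B : SubsetOf V} → Disjoint G A → Disjoint G B → Disjoint G (A ∪ˢ B)
  Disjoint-∪ˢ {A = A} {B} disjA disjB v v∈G v∈A∪B with ∪ˢ-elim A B v∈A∪B
  ... | inj₁ v∈A = disjA v v∈G v∈A
  ... | inj₂ v∈B = disjB v v∈G v∈B

  ∈-singleton⁺ : (dec : DecidableEquality V) (v : V) → v ∈ˢ singleton dec v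
  ∈-singleton⁺ dec v with dec v v
  ... | yes _  = refl
  ... | no v≢v = ⊥-elim (v≢v refl)

  ∈-singleton⁻ : (dec : DecidableEquality V) (v w : V) → w ∈ˢ singleton dec v → v ≡ w
  ∈-singleton⁻ dec v w w∈ with dec v w
  ∈-singleton⁻ dec v w refl | yes v≡w = v≡w

  lk-antitone : (Face : SubsetOf V → Set) →
    (∀ A B → A ⊆ˢ B → Face B → Face A) →
    ∀ {F F′ G} → F ⊆ˢ F′ → lk Face F′ G → lk Face F G
  lk-antitone Face down-closed {G = G} F⊆F′ (faceG , faceG∪F′ , disj) =
    faceG , down-closed _ _ (∪ˢ-monoʳ {A = G} F⊆F′) faceG∪F′ , Disjoint-⊆ʳ F⊆F′ disj

IsEdge-sym : ∀ {n} (K : SimplicialComplex n) {u w} → IsEdge K u w → IsEdge K w u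
IsEdge-sym K {u} {w} (u≢w , face) =
  (λ w≡u → u≢w (sym w≡u)) , down-closed _ _ (∪ˢ-comm-⊆ (singleton FinP._≟_ w) _) face
  where open SimplicialComplex K

module _ {n : ℕ} (K : SimplicialComplex n) (ℓ : Orientation K) where
  open SimplicialComplex K

  Clique : SubsetOf (PVert n) → Set
  Clique G = ∀ x y → x ∈ˢ G → y ∈ˢ G → x ≢ y → RefEdge K ℓ x y

  ∈proj⁺ : ∀ (A : SubsetOf (PVert n)) v s → (v , s) ∈ˢ A → v ∈ˢ proj K ℓ A
  ∈proj⁺ A v true  v,s∈A = ∪ˢ-introˡ (λ v → A (v , true)) (λ v → A (v , false)) v,s∈A
  ∈proj⁺ A v false v,s∈A = ∪ˢ-introʳ (λ v → A (v , true)) (λ v → A (v , false)) v,s∈A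

  ∈proj⁻ : ∀ (A : SubsetOf (PVert n)) v → v ∈ˢ proj K ℓ A → ∃ λ s → (v , s) ∈ˢ A
  ∈proj⁻ A v v∈ with ∪ˢ-elim (λ v → A (v , true)) (λ v → A (v , false)) v∈
  ... | inj₁ v,t∈A = true , v,t∈A
  ... | inj₂ v,f∈A = false , v,f∈A

  proj-⊆ : ∀ (A B : SubsetOf (PVert n)) →
    (∀ v s → (v , s) ∈ˢ A → ∃ λ t → (v , t) ∈ˢ B) → proj K ℓ A ⊆ˢ proj K ℓ B
  proj-⊆ A B fibre v v∈ with ∈proj⁻ A v v∈
  ... | s , v,s∈A with fibre v s v,s∈A
  ...   | t , v,t∈B = ∈proj⁺ B v t v,t∈B

  RefFace-⊆ : ∀ A B → A ⊆ˢ B → RefFace K ℓ B → RefFace K ℓ A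
  RefFace-⊆ A B A⊆B (projB , cliqueB) =
      down-closed _ _ (proj-⊆ A B (λ v s v,s∈A → s , A⊆B (v , s) v,s∈A)) projB
    , λ x y x∈A y∈A → cliqueB x y (A⊆B x x∈A) (A⊆B y y∈A)

  RefEdge-sym : ∀ {x y} → RefEdge K ℓ x y → RefEdge K ℓ y x
  RefEdge-sym (inj₁ (refl , s≢t , vertex)) = inj₁ (refl , (λ t≡s → s≢t (sym t≡s)) , vertex)
  RefEdge-sym (inj₂ (inj₁ (refl , edge))) = inj₂ (inj₁ (refl , IsEdge-sym K edge))
  RefEdge-sym (inj₂ (inj₂ (inj₁ (s≡1 , t≡-1 , u⟶w)))) = inj₂ (inj₂ (inj₂ (t≡-1 , s≡1 , u⟶w)))
  RefEdge-sym (inj₂ (inj₂ (inj₂ (s≡-1 , t≡1 , w⟶u)))) = inj₂ (inj₂ (inj₁ (t≡1 , s≡-1 , w⟶u)))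

  Clique-∪ˢ : ∀ {A B} → Clique A → Clique B →
    (∀ x y → x ∈ˢ A → y ∈ˢ B → x ≢ y → RefEdge K ℓ x y) → Clique (A ∪ˢ B)
  Clique-∪ˢ {A} {B} cliqueA cliqueB cross x y x∈ y∈ x≢y
    with ∪ˢ-elim A B x∈ | ∪ˢ-elim A B y∈
  ... | inj₁ x∈A | inj₁ y∈A = cliqueA x y x∈A y∈A x≢y
  ... | inj₁ x∈A | inj₂ y∈B = cross x y x∈A y∈B x≢y
  ... | inj₂ x∈B | inj₁ y∈A = RefEdge-sym (cross y x y∈A x∈B (λ y≡x → x≢y (sym y≡x)))
  ... | inj₂ x∈B | inj₂ y∈B = cliqueB x y x∈B y∈B x≢y

top bottom : {n : ℕ} → Fin n → SubsetOf (PVert n)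
top    u = singleton _≟ᴾ_ (u , true)
bottom u = singleton _≟ᴾ_ (u , false)

module _ {n : ℕ} (K : SimplicialComplex n) (ℓ : Orientation K)
         (u : Fin n) (vertex-u : IsVertex K u) (G : SubsetOf (PVert n)) where
  open SimplicialComplex K

  lk-top×lk-bottom⇒lk-pair : lk (RefFace K ℓ) (top u) G × lk (RefFace K ℓ) (bottom u) G →
                             lk (RefFace K ℓ) (top u ∪ˢ bottom u) G
  lk-top×lk-bottom⇒lk-pair ((faceG , (projG∪top , cliqueG∪top) , disjTop) ,
                            (_     , (_        , cliqueG∪bottom) , disjBottom)) =
      faceG
    , RefFace-⊆ K ℓ _ _ (∪ˢ-distribˡ-⊆ {A = G})
        ( down-closed _ _ (proj-⊆ K ℓ _ _ fibre) projG∪top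
        , Clique-∪ˢ K ℓ cliqueG∪top cliqueG∪bottom cross)
    , Disjoint-∪ˢ {A = top u} disjTop disjBottom
    where
    fibre : ∀ v s → (v , s) ∈ˢ ((G ∪ˢ top u) ∪ˢ (G ∪ˢ bottom u)) →
            ∃ λ t → (v , t) ∈ˢ (G ∪ˢ top u)
    fibre v s v,s∈ with ∪ˢ-elim (G ∪ˢ top u) (G ∪ˢ bottom u) v,s∈
    ... | inj₁ v,s∈G∪top = s , v,s∈G∪top
    ... | inj₂ v,s∈G∪bottom with ∪ˢ-elim G (bottom u) v,s∈G∪bottom
    ...   | inj₁ v,s∈G = s , ∪ˢ-introˡ G (top u) v,s∈G
    ...   | inj₂ v,s∈bottom with ∈-singleton⁻ _≟ᴾ_ (u , false) (v , s) v,s∈bottom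
    ...     | refl = true , ∪ˢ-introʳ G (top u) (∈-singleton⁺ _≟ᴾ_ (u , true))

    cross : ∀ x y → x ∈ˢ (G ∪ˢ top u) → y ∈ˢ (G ∪ˢ bottom u) → x ≢ y → RefEdge K ℓ x y
    cross x y x∈ y∈ x≢y with ∪ˢ-elim G (top u) x∈ | ∪ˢ-elim G (bottom u) y∈
    ... | inj₁ x∈G   | _             = cliqueG∪bottom x y (∪ˢ-introˡ G (bottom u) x∈G) y∈ x≢y
    ... | inj₂ _     | inj₁ y∈G      = cliqueG∪top x y x∈ (∪ˢ-introˡ G (top u) y∈G) x≢y
    ... | inj₂ x∈top | inj₂ y∈bottom
      with ∈-singleton⁻ _≟ᴾ_ (u , true) x x∈top | ∈-singleton⁻ _≟ᴾ_ (u , false) y y∈bottom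
    ...   | refl | refl = inj₁ (refl , (λ ()) , vertex-u)

lemma3p14 : (n : ℕ) (K : SimplicialComplex n) (ℓ : Orientation K) →
    LocallyAcyclic K ℓ →
    (u : Fin n) → IsVertex K u →
    (G : SubsetOf (PVert n)) →
    (lk (RefFace K ℓ) (singleton _≟ᴾ_ (u , true)) G
      × lk (RefFace K ℓ) (singleton _≟ᴾ_ (u , false)) G)
    ⇔ lk (RefFace K ℓ) (pair _≟ᴾ_ (u , true) (u , false)) G
lemma3p14 n K ℓ _ u vertex-u G =
  mk⇔ (lk-top×lk-bottom⇒lk-pair K ℓ u vertex-u G)
      (λ lk-pair → lk-antitone (RefFace K ℓ) (RefFace-⊆ K ℓ) (⊆-∪ˢˡ (top u) (bottom u)) lk-pair
                 , lk-antitone (RefFace K ℓ) (RefFace-⊆ K ℓ) (⊆-∪ˢʳ (top u) (bottom u)) lk-pair)
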